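{- Let $G,H$ be graphs with $G,H\in\mathfrak{N}$, where $H$ is $r$-regular, and let $n=|V(H)|$. Then the lexicographic product $G[H]$ belongs to $\mathfrak{N}$. Moreover, $w(G[H])\leq w(G)\cdot n+r$ and $W(G[H])\geq W(G)\cdot n+r$.
   Context: All graphs are finite, undirected, without loops or multiple edges. An edge coloring of a graph $G$ with colors $1,2,\ldots,t$ is an interval $t$-coloring if every color $i\in\{1,\ldots,t\}$ is used on at least one edge, and for every vertex $v$ the colors of the edges incident to $v$ are pairwise distinct and form an interval of consecutive integers. $G$ is interval colorable if it has an interval $t$-coloring for some integer $t\geq 1$; $\mathfrak{N}$ denotes the set of interval colorable graphs. For $G\in\mathfrak{N}$, $w(G)$ and $W(G)$ denote the least and greatest $t$ for which $G$ has an interval $t$-coloring. The lexicographic product $G[H]$ has vertex set $V(G)\times V(H)$, with $(u_1,v_1)$ adjacent to $(u_2,v_2)$ iff either $u_1u_2\in E(G)$, or ($u_1=u_2$ and $v_1v_2\in E(H)$). -}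

module Defs where

open import Data.Nat using (ℕ; zero; suc; _+_; _*_; _≤_; _<_)
open import Data.Fin using (Fin; remQuot)
open import Data.Bool using (Bool; true; false; if_then_else_; _∨_; _∧_)
open import Data.List using (List; map; allFin)
open import Data.Nat.ListAction using (sum)
open import Data.Fin using (_≟_)
open import Relation.Nullary.Decidable using (⌊_⌋; yes; no)
open import Relation.Binary.PropositionalEquality using (refl; sym; cong₂)
open import Data.Product using (Σ; ∃; _×_; _,_; proj₁; proj₂)
open import Relation.Binary.PropositionalEquality using (_≡_; _≢_)

record Graph : Set where
  field
    n        : ℕ
    adj      : Fin n → Fin n → Bool
    adj-sym  : ∀ u v → adj u v ≡ adj v u
    adj-irr  : ∀ v → adj v v ≡ false
open Graph public

deg : (G : Graph) → Fin (n G) → ℕ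
deg G v = sum (map (λ u → if adj G v u then 1 else 0) (allFin (n G)))

Regular : Graph → ℕ → Set
Regular G r = ∀ v → deg G v ≡ r

-- An edge colouring: c u v is the colour of the edge uv (values on
-- non-edges are irrelevant); it must be symmetric on edges.
EdgeColouring : Graph → Set
EdgeColouring G = Fin (n G) → Fin (n G) → ℕ

record IsIntervalColouring (G : Graph) (t : ℕ) (c : EdgeColouring G) : Set where
  field
    symm     : ∀ u v → adj G u v ≡ true → c u v ≡ c v u
    range    : ∀ u v → adj G u v ≡ true → 1 ≤ c u v × c u v ≤ t
    used     : ∀ i → 1 ≤ i → i ≤ t →
               Σ (Fin (n G)) λ u → Σ (Fin (n G)) λ v → adj G u v ≡ true × c u v ≡ i
    proper   : ∀ v u u' → adj G v u ≡ true → adj G v u' ≡ true → u ≢ u' → c v u ≢ c v u'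
    interval : ∀ v u u' k → adj G v u ≡ true → adj G v u' ≡ true →
               c v u ≤ k → k ≤ c v u' →
               Σ (Fin (n G)) λ x → adj G v x ≡ true × c v x ≡ k

HasIntervalColouring : Graph → ℕ → Set
HasIntervalColouring G t = Σ (EdgeColouring G) (IsIntervalColouring G t)

IntervalColourable : Graph → Set
IntervalColourable G = Σ ℕ λ t → 1 ≤ t × HasIntervalColouring G t

IsLeastColours : Graph → ℕ → Set
IsLeastColours G t = HasIntervalColouring G t × (∀ t' → HasIntervalColouring G t' → t ≤ t')

IsGreatestColours : Graph → ℕ → Set
IsGreatestColours G T = HasIntervalColouring G T × (∀ t' → HasIntervalColouring G t' → t' ≤ T)

-- Lexicographic product G[H] on Fin (|V(G)| * |V(H)|); the vertex
-- (u , x) ∈ V(G) × V(H) is encoded via remQuot / combine.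
lexAdj' : (G H : Graph) → Fin (n G) × Fin (n H) → Fin (n G) × Fin (n H) → Bool
lexAdj' G H (u₁ , v₁) (u₂ , v₂) = adj G u₁ u₂ ∨ (⌊ u₁ ≟ u₂ ⌋ ∧ adj H v₁ v₂)

private
  eqb-sym : ∀ {k} (a b : Fin k) → ⌊ a ≟ b ⌋ ≡ ⌊ b ≟ a ⌋
  eqb-sym a b with a ≟ b | b ≟ a
  ... | yes _ | yes _ = refl
  ... | no _ | no _ = refl
  ... | yes p | no q = Data.Empty.⊥-elim (q (sym p))
    where import Data.Empty
  ... | no p | yes q = Data.Empty.⊥-elim (p (sym q))
    where import Data.Empty

  eqb-refl : ∀ {k} (a : Fin k) → ⌊ a ≟ a ⌋ ≡ true
  eqb-refl a with a ≟ a
  ... | yes _ = refl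
  ... | no p = Data.Empty.⊥-elim (p refl)
    where import Data.Empty

  lexAdj'-sym : ∀ G H p q → lexAdj' G H p q ≡ lexAdj' G H q p
  lexAdj'-sym G H (u₁ , v₁) (u₂ , v₂) =
    cong₂ _∨_ (adj-sym G u₁ u₂) (cong₂ _∧_ (eqb-sym u₁ u₂) (adj-sym H v₁ v₂))

  lexAdj'-irr : ∀ G H p → lexAdj' G H p p ≡ false
  lexAdj'-irr G H (u , v) rewrite adj-irr G u | eqb-refl u | adj-irr H v = refl

_[_] : Graph → Graph → Graph
G [ H ] = record
  { n       = n G * n H
  ; adj     = λ a b → lexAdj' G H (remQuot {n G} (n H) a) (remQuot {n G} (n H) b)
  ; adj-sym = λ a b → lexAdj'-sym G H (remQuot {n G} (n H) a) (remQuot {n G} (n H) b)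
  ; adj-irr = λ a → lexAdj'-irr G H (remQuot {n G} (n H) a)
  }

-- Let α be an interval t-colouring of G, γ one of the r-regular graph H, m = |V(H)|, and
-- top(u) the largest α-colour at u. An edge uv of G becomes the complete bipartite graph
-- between the copies of H at u and v, coloured inside the block ((α(uv) − 1)m, α(uv)m] by the
-- Latin square (x , y) ↦ (x + y) mod m. The copy of H at u is coloured by γ mod r shifted
-- to (top(u)m, top(u)m + r]; this is proper because the γ-colours at a vertex form an
-- interval of exactly r integers. At every vertex the colours then form an interval, and
-- tm + r colours are used. The bounds on w and W follow because having an interval t-colouring
-- is decidable and forces t ≤ |V|², so least and greatest numbers of colours exist.
module Submission where

open import Defs
open import Data.Nat
  using (ℕ; zero; suc; pred; _+_; _*_; _∸_; _^_; _≤_; _<_; _⊔_; z≤n; s≤s; s≤s⁻¹; _≤?_)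
open import Data.Nat using (NonZero; >-nonZero)
open import Data.Nat.Properties
open import Data.Nat.DivMod
open import Data.Nat.ListAction using (sum)
open import Data.List using (map; tabulate; allFin)
open import Data.List.Properties using (map-tabulate)
open import Data.Fin using (Fin; toℕ; fromℕ<; punchOut; remQuot; combine; finToFun; funToFin)
  renaming (zero to fzero; suc to fsuc)
open import Data.Fin.Properties as Fin
  using (toℕ-injective; toℕ<n; toℕ-fromℕ<; injective⇒≤; punchOut-injective; any?; all?)
open import Data.Bool using (Bool; true; false; if_then_else_; _∨_)
import Data.Bool.Properties
open import Data.Product using (Σ; ∃; _×_; _,_; proj₁; proj₂)
open import Data.Sum using (inj₁; inj₂)
open import Relation.Nullary using (Dec; yes; no; contradiction)
open import Relation.Nullary.Decidable using (map′; _×-dec_; _→-dec_; ¬?)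
open import Relation.Unary using (Decidable)
open import Relation.Binary.PropositionalEquality hiding ([_])

count : ∀ k → (Fin k → Bool) → ℕ
count zero    p = 0
count (suc k) p = (if p fzero then 1 else 0) + count k (λ i → p (fsuc i))

deg≡count : ∀ G v → deg G v ≡ count (n G) (adj G v)
deg≡count G v = go (n G) (adj G v)
  where
  go : ∀ k (p : Fin k → Bool) → sum (map (λ u → if p u then 1 else 0) (allFin k)) ≡ count k p
  go zero    p = refl
  go (suc k) p = cong ((if p fzero then 1 else 0) +_) (begin
    sum (map (λ u → if p u then 1 else 0) (tabulate fsuc))
      ≡⟨ cong sum (map-tabulate fsuc (λ u → if p u then 1 else 0)) ⟩
    sum (tabulate (λ u → if p (fsuc u) then 1 else 0))
      ≡⟨ cong sum (sym (map-tabulate (λ u → u) (λ u → if p (fsuc u) then 1 else 0))) ⟩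
    sum (map (λ u → if p (fsuc u) then 1 else 0) (allFin k))
      ≡⟨ go k (λ i → p (fsuc i)) ⟩
    count k (λ i → p (fsuc i)) ∎)
    where open ≡-Reasoning

enum : ∀ k (p : Fin k → Bool) → Fin (count k p) → Fin k
enum (suc k) p j with p fzero
enum (suc k) p fzero    | true  = fzero
enum (suc k) p (fsuc j) | true  = fsuc (enum k (λ i → p (fsuc i)) j)
enum (suc k) p j        | false = fsuc (enum k (λ i → p (fsuc i)) j)

enum-true : ∀ k (p : Fin k → Bool) j → p (enum k p j) ≡ true
enum-true (suc k) p j with p fzero in eq
enum-true (suc k) p fzero    | true  = eq
enum-true (suc k) p (fsuc j) | true  = enum-true k (λ i → p (fsuc i)) j
enum-true (suc k) p j        | false = enum-true k (λ i → p (fsuc i)) j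

enum-injective : ∀ k (p : Fin k → Bool) {j j'} → enum k p j ≡ enum k p j' → j ≡ j'
enum-injective (suc k) p {j} {j'} e with p fzero
enum-injective (suc k) p {fzero}  {fzero}   e | true = refl
enum-injective (suc k) p {fsuc j} {fsuc j'} e | true =
  cong fsuc (enum-injective k (λ i → p (fsuc i)) (Fin.suc-injective e))
enum-injective (suc k) p {j} {j'} e | false =
  enum-injective k (λ i → p (fsuc i)) (Fin.suc-injective e)

enum-surjective : ∀ k (p : Fin k → Bool) i → p i ≡ true → ∃ λ j → enum k p j ≡ i
enum-surjective (suc k) p i pi with p fzero in eq
enum-surjective (suc k) p fzero pi | true = fzero , refl
enum-surjective (suc k) p fzero pi | false = contradiction (trans (sym eq) pi) λ ()
enum-surjective (suc k) p (fsuc i) pi | true =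
  let j , e = enum-surjective k (λ i → p (fsuc i)) i pi in fsuc j , cong fsuc e
enum-surjective (suc k) p (fsuc i) pi | false =
  let j , e = enum-surjective k (λ i → p (fsuc i)) i pi in j , cong fsuc e

injection⇒≤count : ∀ {a} k (p : Fin k → Bool) (f : Fin a → Fin k) →
                   (∀ {i j} → f i ≡ f j → i ≡ j) → (∀ i → p (f i) ≡ true) → a ≤ count k p
injection⇒≤count k p f f-injective f-true = injective⇒≤ {f = index} index-injective
  where
  index : _ → Fin (count k p)
  index i = proj₁ (enum-surjective k p (f i) (f-true i))
  index-injective : ∀ {i j} → index i ≡ index j → i ≡ j
  index-injective {i} {j} e = f-injective (begin
    f i                 ≡⟨ proj₂ (enum-surjective k p (f i) (f-true i)) ⟨
    enum k p (index i)  ≡⟨ cong (enum k p) e ⟩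
    enum k p (index j)  ≡⟨ proj₂ (enum-surjective k p (f j) (f-true j)) ⟩
    f j                 ∎)
    where open ≡-Reasoning

injective⇒surjective : ∀ {a b} (f : Fin a → Fin b) → (∀ {i j} → f i ≡ f j → i ≡ j) → b ≤ a →
                       ∀ j → ∃ λ i → f i ≡ j
injective⇒surjective {a} {suc b} f f-injective b≤a j with any? (λ i → f i Fin.≟ j)
... | yes hit = hit
... | no miss = contradiction (injective⇒≤ {f = g} g-injective) (<⇒≱ b≤a)
  where
  avoids : ∀ i → j ≢ f i
  avoids i e = miss (i , sym e)
  g : Fin a → Fin b
  g i = punchOut (avoids i)
  g-injective : ∀ {i i'} → g i ≡ g i' → i ≡ i'
  g-injective e = f-injective (punchOut-injective (avoids _) (avoids _) e)

injective⇒onto-below : ∀ {a b} (g : Fin a → ℕ) → (∀ i → g i < b) →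
                       (∀ {i j} → g i ≡ g j → i ≡ j) → b ≤ a →
                       ∀ s → s < b → ∃ λ i → g i ≡ s
injective⇒onto-below g g<b g-injective b≤a s s<b =
  let i , fi≡s = injective⇒surjective f f-injective b≤a (fromℕ< s<b) in
  i , (begin
    g i              ≡⟨ toℕ-fromℕ< (g<b i) ⟨
    toℕ (f i)        ≡⟨ cong toℕ fi≡s ⟩
    toℕ (fromℕ< s<b) ≡⟨ toℕ-fromℕ< s<b ⟩
    s                ∎)
  where
  open ≡-Reasoning
  f : Fin _ → Fin _
  f i = fromℕ< (g<b i)
  f-injective : ∀ {i j} → f i ≡ f j → i ≡ j
  f-injective {i} {j} e = g-injective (begin
    g i        ≡⟨ toℕ-fromℕ< (g<b i) ⟨
    toℕ (f i)  ≡⟨ cong toℕ e ⟩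
    toℕ (f j)  ≡⟨ toℕ-fromℕ< (g<b j) ⟩
    g j        ∎)

maximum : ∀ k → (Fin k → ℕ) → ℕ
maximum zero    f = 0
maximum (suc k) f = f fzero ⊔ maximum k (λ i → f (fsuc i))

≤maximum : ∀ k (f : Fin k → ℕ) i → f i ≤ maximum k f
≤maximum (suc k) f fzero    = m≤m⊔n _ _
≤maximum (suc k) f (fsuc i) = ≤-trans (≤maximum k (λ i → f (fsuc i)) i) (m≤n⊔m _ _)

maximum≤ : ∀ k (f : Fin k → ℕ) {b} → (∀ i → f i ≤ b) → maximum k f ≤ b
maximum≤ zero    f f≤b = z≤n
maximum≤ (suc k) f f≤b = ⊔-lub (f≤b fzero) (maximum≤ k (λ i → f (fsuc i)) (λ i → f≤b (fsuc i)))

maximum-attained : ∀ k (f : Fin k → ℕ) → 0 < maximum k f → ∃ λ i → f i ≡ maximum k f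
maximum-attained (suc k) f pos with ⊔-sel (f fzero) (maximum k (λ i → f (fsuc i)))
... | inj₁ e = fzero , sym e
... | inj₂ e with i , e' ← maximum-attained k (λ i → f (fsuc i)) (subst (0 <_) e pos)
  = fsuc i , trans e' (sym e)

%-injective-window : ∀ {a b m} .{{_ : NonZero m}} → a ≤ b → b < a + m → a % m ≡ b % m → a ≡ b
%-injective-window {a} {b} {m} a≤b b<a+m eq =
  trans a≡ (trans (cong (λ q → a % m + q * m) (≤-antisym qa≤qb (s≤s⁻¹ qb<1+qa))) (sym b≡))
  where
  a≡ : a ≡ a % m + a / m * m
  a≡ = m≡m%n+[m/n]*n a m
  b≡ : b ≡ a % m + b / m * m
  b≡ = trans (m≡m%n+[m/n]*n b m) (cong (_+ b / m * m) (sym eq))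
  qa≤qb : a / m ≤ b / m
  qa≤qb = *-cancelʳ-≤ (a / m) (b / m) m (+-cancelˡ-≤ (a % m) _ _ (subst₂ _≤_ a≡ b≡ a≤b))
  qb<1+qa : b / m < suc (a / m)
  qb<1+qa = *-cancelʳ-< m (b / m) (suc (a / m)) (+-cancelˡ-< (a % m) _ _ (begin-strict
    a % m + b / m * m        ≡⟨ b≡ ⟨
    b                        <⟨ b<a+m ⟩
    a + m                    ≡⟨ cong (_+ m) a≡ ⟩
    a % m + a / m * m + m    ≡⟨ +-assoc (a % m) _ m ⟩
    a % m + (a / m * m + m)  ≡⟨ cong (a % m +_) (+-comm (a / m * m) m) ⟩
    a % m + suc (a / m) * m  ∎))
    where open ≤-Reasoning

%-injective-within : ∀ {a b m} .{{_ : NonZero m}} → a < b + m → b < a + m → a % m ≡ b % m → a ≡ b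
%-injective-within {a} {b} a<b+m b<a+m eq with ≤-total a b
... | inj₁ a≤b = %-injective-window a≤b b<a+m eq
... | inj₂ b≤a = sym (%-injective-window b≤a a<b+m (sym eq))

+*-injective : ∀ {m s s' q q'} .{{_ : NonZero m}} → s < m → s' < m →
               s + q * m ≡ s' + q' * m → s ≡ s' × q ≡ q'
+*-injective {m} {s} {s'} {q} {q'} s<m s'<m eq = s≡s' , q≡q'
  where
  s≡s' : s ≡ s'
  s≡s' = begin
    s                ≡⟨ m<n⇒m%n≡m s<m ⟨
    s % m            ≡⟨ [m+kn]%n≡m%n s q m ⟨
    (s + q * m) % m  ≡⟨ cong (_% m) eq ⟩
    (s' + q' * m) % m ≡⟨ [m+kn]%n≡m%n s' q' m ⟩
    s' % m           ≡⟨ m<n⇒m%n≡m s'<m ⟩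
    s'               ∎
    where open ≡-Reasoning
  q≡q' : q ≡ q'
  q≡q' = *-cancelʳ-≡ q q' m (+-cancelˡ-≡ s _ _ (trans eq (cong (_+ q' * m) (sym s≡s'))))

window-offset : ∀ {b k w} → b < k → k ≤ w + b → ∃ λ j → j < w × suc (j + b) ≡ k
window-offset {b} {suc k} {w} (s≤s b≤k) k<w+b =
  k ∸ b ,
  +-cancelʳ-≤ b _ _ (subst (_≤ w + b) (cong suc (sym (m∸n+n≡m b≤k))) k<w+b) ,
  cong suc (m∸n+n≡m b≤k)

module _ {P : ℕ → Set} where

  Least : ℕ → Set
  Least t = P t × (∀ t' → P t' → t ≤ t')

  Greatest : ℕ → Set
  Greatest t = P t × (∀ t' → P t' → t' ≤ t)

  least : Decidable P → ∀ {k} → P k → ∃ Least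
  least P? {k} pk = search 0 k (λ _ _ → z≤n) (subst P (sym (+-identityʳ k)) pk)
    where
    search : ∀ m d → (∀ t → P t → m ≤ t) → P (d + m) → ∃ Least
    search m d above pd+m with P? m
    ... | yes pm = m , pm , above
    search m zero    above pm     | no ¬pm = contradiction pm ¬pm
    search m (suc d) above pd+1+m | no ¬pm =
      search (suc m) d above′ (subst P (sym (+-suc d m)) pd+1+m)
      where
      above′ : ∀ t → P t → suc m ≤ t
      above′ t pt = ≤∧≢⇒< (above t pt) (λ { refl → ¬pm pt })

  greatest : Decidable P → ∀ {b k} → (∀ t → P t → t ≤ b) → P k → ∃ Greatest
  greatest P? {b} below pk with P? b
  ... | yes pb = b , pb , below
  greatest P? {zero}  {k} below pk | no ¬p0 with refl ← n≤0⇒n≡0 (below k pk) = contradiction pk ¬p0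
  greatest P? {suc b} below pk | no ¬pb = greatest P? below′ pk
    where
    below′ : ∀ t → P t → t ≤ b
    below′ t pt = s≤s⁻¹ (≤∧≢⇒< (below t pt) (λ { refl → ¬pb pt }))

module _ (G : Graph) where

  private
    adj? : ∀ u v → Dec (adj G u v ≡ true)
    adj? u v = adj G u v Data.Bool.Properties.≟ true

  isIntervalColouring? : ∀ t c → Dec (IsIntervalColouring G t c)
  isIntervalColouring? t c =
    map′ (λ (s , r , u , p , i) → record
           { symm = s ; range = r ; used = u ; proper = p ; interval = i })
         (λ ic → let open IsIntervalColouring ic in symm , range , used , proper , interval)
         (symm? ×-dec range? ×-dec used? ×-dec proper? ×-dec interval?)
    where
    symm? : Dec (∀ u v → adj G u v ≡ true → c u v ≡ c v u)
    symm? = all? λ u → all? λ v → adj? u v →-dec c u v ≟ c v u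
    range? : Dec (∀ u v → adj G u v ≡ true → 1 ≤ c u v × c u v ≤ t)
    range? = all? λ u → all? λ v → adj? u v →-dec (1 ≤? c u v ×-dec c u v ≤? t)
    used? : Dec (∀ i → 1 ≤ i → i ≤ t → ∃ λ u → ∃ λ v → adj G u v ≡ true × c u v ≡ i)
    used? =
      map′ (λ f i 1≤i i≤t → f (s≤s i≤t) 1≤i)
           (λ f {i} i<1+t 1≤i → f i 1≤i (s≤s⁻¹ i<1+t))
      (allUpTo? (λ i → 1 ≤? i →-dec any? λ u → any? λ v → adj? u v ×-dec c u v ≟ i) (suc t))
    proper? : Dec (∀ v u u' → adj G v u ≡ true → adj G v u' ≡ true → u ≢ u' → c v u ≢ c v u')
    proper? = all? λ v → all? λ u → all? λ u' →
      adj? v u →-dec adj? v u' →-dec ¬? (u Fin.≟ u') →-dec ¬? (c v u ≟ c v u')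
    interval? : Dec (∀ v u u' k → adj G v u ≡ true → adj G v u' ≡ true → c v u ≤ k → k ≤ c v u' →
                       ∃ λ x → adj G v x ≡ true × c v x ≡ k)
    interval? =
      map′ (λ f v u u' k vu vu' l l' → f v u u' vu vu' (s≤s l') l)
           (λ f v u u' vu vu' {k} k< l → f v u u' k vu vu' l (s≤s⁻¹ k<))
        (all? λ v → all? λ u → all? λ u' → adj? v u →-dec adj? v u' →-dec
          allUpTo? (λ k → c v u ≤? k →-dec any? λ x → adj? v x ×-dec c v x ≟ k) (suc (c v u')))

  isIntervalColouring-cong : ∀ {t} {c c' : EdgeColouring G} →
                             (∀ u v → adj G u v ≡ true → c u v ≡ c' u v) →
                             IsIntervalColouring G t c → IsIntervalColouring G t c'
  isIntervalColouring-cong {t} {c} {c'} c≡c' ic = record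
    { symm = λ u v uv → trans (sym (c≡c' u v uv))
                          (trans (symm u v uv) (c≡c' v u (trans (adj-sym G v u) uv)))
    ; range = λ u v uv → subst (λ k → 1 ≤ k × k ≤ t) (c≡c' u v uv) (range u v uv)
    ; used = λ i 1≤i i≤t → let u , v , uv , e = used i 1≤i i≤t in
                           u , v , uv , trans (sym (c≡c' u v uv)) e
    ; proper = λ v u u' vu vu' u≢u' e →
        proper v u u' vu vu' u≢u' (trans (c≡c' v u vu) (trans e (sym (c≡c' v u' vu'))))
    ; interval = λ v u u' k vu vu' l l' →
        let x , vx , e = interval v u u' k vu vu' (subst (_≤ k) (sym (c≡c' v u vu)) l)
                                                  (subst (k ≤_) (sym (c≡c' v u' vu')) l')
        in x , vx , trans (sym (c≡c' v x vx)) e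
    }
    where open IsIntervalColouring ic

  -- Values off the edges are irrelevant and values on edges are at most t, so it suffices
  -- to search the colourings with values in Fin (suc t), enumerated by Fin (suc t ^ (n G * n G)).
  hasIntervalColouring? : ∀ t → Dec (HasIntervalColouring G t)
  hasIntervalColouring? t =
    map′ (λ (i , ic) → decode i , ic)
         (λ (c , ic) → encode c ,
            isIntervalColouring-cong
              (λ u v uv → sym (decode-encode c u v (proj₂ (IsIntervalColouring.range ic u v uv)))) ic)
         (any? λ i → isIntervalColouring? t (decode i))
    where
    decode : Fin (suc t ^ (n G * n G)) → EdgeColouring G
    decode i u v = toℕ (finToFun i (combine u v))
    encode : EdgeColouring G → Fin (suc t ^ (n G * n G))
    encode c = funToFin λ k → let u , v = remQuot (n G) k in c u v mod suc t
    decode-encode : ∀ c u v → c u v ≤ t → decode (encode c) u v ≡ c u v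
    decode-encode c u v c≤t = begin
      decode (encode c) u v
        ≡⟨ cong toℕ (Fin.finToFun-funToFin _ (combine u v)) ⟩
      toℕ (let u′ , v′ = remQuot (n G) (combine u v) in c u′ v′ mod suc t)
        ≡⟨ cong (λ (u′ , v′) → toℕ (c u′ v′ mod suc t)) (Fin.remQuot-combine u v) ⟩
      toℕ (c u v mod suc t)
        ≡⟨ toℕ-fromℕ< (m%n<n (c u v) (suc t)) ⟩
      c u v % suc t
        ≡⟨ m≤n⇒m%n≡m c≤t ⟩
      c u v ∎
      where open ≡-Reasoning

  colours≤n² : ∀ {t} → HasIntervalColouring G t → t ≤ n G * n G
  colours≤n² {t} (c , ic) = injective⇒≤ {f = edge-of} edge-of-injective
    where
    open IsIntervalColouring ic
    witness : (i : Fin t) → _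
    witness i = used (suc (toℕ i)) (s≤s z≤n) (toℕ<n i)
    edge-of : Fin t → Fin (n G * n G)
    edge-of i = let u , v , _ = witness i in combine u v
    edge-of-injective : ∀ {i j} → edge-of i ≡ edge-of j → i ≡ j
    edge-of-injective {i} {j} e
      with u , v , _ , ci ← witness i | u' , v' , _ , cj ← witness j
      with refl , refl ← Fin.combine-injective u v u' v' e
      = toℕ-injective (suc-injective (trans (sym ci) cj))

colourable⇒edge : ∀ {G} → IntervalColourable G → ∃ λ u → ∃ λ v → adj G u v ≡ true
colourable⇒edge (_ , 1≤t , _ , ic) = let u , v , uv , _ = IsIntervalColouring.used ic 1 ≤-refl 1≤t in u , v , uv

injection⇒≤deg : ∀ G {a} x (f : Fin a → Fin (n G)) → (∀ {i j} → f i ≡ f j → i ≡ j) →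
                 (∀ i → adj G x (f i) ≡ true) → a ≤ deg G x
injection⇒≤deg G x f f-injective f-adj =
  subst (_ ≤_) (sym (deg≡count G x)) (injection⇒≤count (n G) (adj G x) f f-injective f-adj)

edge⇒1≤deg : ∀ G {x y} → adj G x y ≡ true → 1 ≤ deg G x
edge⇒1≤deg G {y = y} xy = injection⇒≤deg G _ (λ _ → y) (λ { {fzero} {fzero} _ → refl }) (λ _ → xy)

module IntervalColouring {G : Graph} {t : ℕ} {c : EdgeColouring G} (ic : IsIntervalColouring G t c) where

  open IsIntervalColouring ic

  edge⇒1≤colours : ∀ {u v} → adj G u v ≡ true → 1 ≤ t
  edge⇒1≤colours {u} {v} uv = ≤-trans (proj₁ (range u v uv)) (proj₂ (range u v uv))

  colour-injective : ∀ {v u u'} → adj G v u ≡ true → adj G v u' ≡ true → c v u ≡ c v u' → u ≡ u'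
  colour-injective {v} {u} {u'} vu vu' e with u Fin.≟ u'
  ... | yes u≡u' = u≡u'
  ... | no u≢u' = contradiction e (proper v u u' vu vu' u≢u')

  top : Fin (n G) → ℕ
  top u = maximum (n G) λ v → if adj G u v then c u v else 0

  ≤top : ∀ {u v} → adj G u v ≡ true → c u v ≤ top u
  ≤top {u} {v} uv = subst (λ b → (if b then c u v else 0) ≤ top u) uv
    (≤maximum (n G) (λ v → if adj G u v then c u v else 0) v)

  top≤colours : ∀ u → top u ≤ t
  top≤colours u = maximum≤ (n G) _ bounded
    where
    bounded : ∀ v → (if adj G u v then c u v else 0) ≤ t
    bounded v with adj G u v in uv
    ... | true  = proj₂ (range u v uv)
    ... | false = z≤n

  top-attained : ∀ u → 0 < top u → ∃ λ v → adj G u v ≡ true × c u v ≡ top u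
  top-attained u 0<top with maximum-attained (n G) (λ v → if adj G u v then c u v else 0) 0<top
  ... | v , e with adj G u v in uv
  ...   | true  = v , uv , e
  ...   | false = contradiction e (<⇒≢ 0<top)

  colour-span : ∀ {x y y'} → adj G x y ≡ true → adj G x y' ≡ true → c x y' < c x y + deg G x
  colour-span {x} {y} {y'} xy xy' = ≰⇒> λ long → 1+n≰n (too-many long)
    where
    -- otherwise c x y, c x y + 1, …, c x y + deg x would all be colours of edges at x
    too-many : c x y + deg G x ≤ c x y' → suc (deg G x) ≤ deg G x
    too-many long = injection⇒≤deg G x (λ j → proj₁ (w j)) w-injective (λ j → proj₁ (proj₂ (w j)))
      where
      w : (j : Fin (suc (deg G x))) → ∃ λ z → adj G x z ≡ true × c x z ≡ c x y + toℕ j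
      w j = interval x y y' (c x y + toℕ j) xy xy' (m≤m+n _ _)
              (≤-trans (+-monoʳ-≤ (c x y) (s≤s⁻¹ (toℕ<n j))) long)
      w-injective : ∀ {i j} → proj₁ (w i) ≡ proj₁ (w j) → i ≡ j
      w-injective {i} {j} e = toℕ-injective (+-cancelˡ-≡ (c x y) _ _
        (trans (sym (proj₂ (proj₂ (w i)))) (trans (cong (c x) e) (proj₂ (proj₂ (w j))))))

  residue-injective : ∀ {d} .{{_ : NonZero d}} {x y y'} → deg G x ≡ d →
                      adj G x y ≡ true → adj G x y' ≡ true → c x y % d ≡ c x y' % d → y ≡ y'
  residue-injective {d} {x} deg≡d xy xy' e =
    colour-injective xy xy' (%-injective-within (span xy' xy) (span xy xy') e)
    where
    span : ∀ {y y'} → adj G x y ≡ true → adj G x y' ≡ true → c x y' < c x y + d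
    span xy xy' = subst (λ k → _ < _ + k) deg≡d (colour-span xy xy')

  residue-surjective : ∀ {d} .{{_ : NonZero d}} {x} → deg G x ≡ d →
                       ∀ j → j < d → ∃ λ y → adj G x y ≡ true × c x y % d ≡ j
  residue-surjective {d} {x} deg≡d j j<d =
    let k , e = injective⇒onto-below residue (λ k → m%n<n _ d) residue-injective′ d≤count j j<d
    in enum (n G) (adj G x) k , enum-true (n G) (adj G x) k , e
    where
    residue : Fin (count (n G) (adj G x)) → ℕ
    residue k = c x (enum (n G) (adj G x) k) % d
    residue-injective′ : ∀ {k k'} → residue k ≡ residue k' → k ≡ k'
    residue-injective′ {k} {k'} e = enum-injective (n G) (adj G x)
      (residue-injective deg≡d (enum-true (n G) (adj G x) k) (enum-true (n G) (adj G x) k') e)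
    d≤count : d ≤ count (n G) (adj G x)
    d≤count = ≤-reflexive (trans (sym deg≡d) (deg≡count G x))

module _ {m : ℕ} .{{_ : NonZero m}} where

  sumMod : Fin m → Fin m → ℕ
  sumMod x y = (toℕ x + toℕ y) % m

  sumMod<m : ∀ x y → sumMod x y < m
  sumMod<m x y = m%n<n _ m

  sumMod-comm : ∀ x y → sumMod x y ≡ sumMod y x
  sumMod-comm x y = cong (_% m) (+-comm (toℕ x) (toℕ y))

  sumMod-injectiveʳ : ∀ x {y y'} → sumMod x y ≡ sumMod x y' → y ≡ y'
  sumMod-injectiveʳ x {y} {y'} e =
    toℕ-injective (+-cancelˡ-≡ (toℕ x) _ _ (%-injective-within (near y y') (near y' y) e))
    where
    near : ∀ z z' → toℕ x + toℕ z < toℕ x + toℕ z' + m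
    near z z' = <-≤-trans (+-monoʳ-< (toℕ x) (toℕ<n z)) (+-monoˡ-≤ m (m≤m+n (toℕ x) (toℕ z')))

  sumMod-surjectiveʳ : ∀ x s → s < m → ∃ λ y → sumMod x y ≡ s
  sumMod-surjectiveʳ x = injective⇒onto-below (sumMod x) (sumMod<m x) (sumMod-injectiveʳ x) ≤-refl

module _ (G H : Graph) where

  data LexEdge : Fin (n G) × Fin (n H) → Fin (n G) × Fin (n H) → Set where
    outer : ∀ {u v x y} → adj G u v ≡ true → LexEdge (u , x) (v , y)
    inner : ∀ {u x y} → adj H x y ≡ true → LexEdge (u , x) (u , y)

  lexEdge : ∀ p q → lexAdj' G H p q ≡ true → LexEdge p q
  lexEdge (u , x) (v , y) e with adj G u v in uv | u Fin.≟ v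
  ... | true  | _        = outer uv
  ... | false | yes refl = inner e

  lexEdge⁻¹ : ∀ {p q} → LexEdge p q → lexAdj' G H p q ≡ true
  lexEdge⁻¹ (outer uv) rewrite uv = refl
  lexEdge⁻¹ (inner {u} xy) with u Fin.≟ u
  ... | yes _  rewrite adj-irr G u | xy = refl
  ... | no u≢u = contradiction refl u≢u

module LexProductColouring
  {G H : Graph} {r : ℕ} (H-regular : Regular H r)
  {t : ℕ} {α : EdgeColouring G} (α-interval : IsIntervalColouring G t α) (1≤t : 1 ≤ t)
  {tH : ℕ} {γ : EdgeColouring H} (γ-interval : IsIntervalColouring H tH γ)
  {x₀ y₀ : Fin (n H)} (x₀y₀ : adj H x₀ y₀ ≡ true)
  where

  private
    m = n H
    module α = IsIntervalColouring α-interval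
    module γ = IsIntervalColouring γ-interval
    open IntervalColouring α-interval using (top; ≤top; top≤colours; top-attained)

  instance
    m≢0 : NonZero m
    m≢0 = >-nonZero (≤-<-trans z≤n (toℕ<n x₀))
    r≢0 : NonZero r
    r≢0 = >-nonZero (subst (1 ≤_) (H-regular x₀) (edge⇒1≤deg H x₀y₀))

  outerColour : ℕ → Fin m → Fin m → ℕ
  outerColour a x y = suc (sumMod x y + pred a * m)

  innerColour : Fin (n G) → Fin m → Fin m → ℕ
  innerColour u x y = suc (γ x y % r + top u * m)

  colour : Fin (n G) × Fin m → Fin (n G) × Fin m → ℕ
  colour (u , x) (v , y) = if adj G u v then outerColour (α u v) x y else innerColour u x y

  colour-outer : ∀ {u v x y} → adj G u v ≡ true → colour (u , x) (v , y) ≡ outerColour (α u v) x y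
  colour-outer uv rewrite uv = refl

  colour-inner : ∀ {u x y} → colour (u , x) (u , y) ≡ innerColour u x y
  colour-inner {u} rewrite adj-irr G u = refl

  outerColour≤ : ∀ {a} x y → 1 ≤ a → outerColour a x y ≤ a * m
  outerColour≤ {suc a} x y _ = +-monoˡ-< (a * m) (sumMod<m x y)

  outerColour≤top : ∀ {u v} x y → adj G u v ≡ true → outerColour (α u v) x y ≤ top u * m
  outerColour≤top {u} {v} x y uv =
    ≤-trans (outerColour≤ x y (proj₁ (α.range u v uv))) (*-monoˡ-≤ m (≤top uv))

  top<innerColour : ∀ u x y → top u * m < innerColour u x y
  top<innerColour u x y = s≤s (m≤n+m _ _)

  innerColour≤ : ∀ u x y → innerColour u x y ≤ r + top u * m
  innerColour≤ u x y = +-monoˡ-< (top u * m) (m%n<n _ r)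

  Attained : Fin (n G) × Fin m → ℕ → Set
  Attained p k = ∃ λ q → lexAdj' G H p q ≡ true × colour p q ≡ k

  outer-attained : ∀ {u v} x k → adj G u v ≡ true → α u v ≡ suc (k / m) → Attained (u , x) (suc k)
  outer-attained {u} {v} x k uv αuv≡ =
    let y , y≡ = sumMod-surjectiveʳ x (k % m) (m%n<n k m) in
    (v , y) , lexEdge⁻¹ G H (outer uv) , (begin
      colour (u , x) (v , y)                  ≡⟨ colour-outer uv ⟩
      suc (sumMod x y + pred (α u v) * m)     ≡⟨ cong₂ (λ s q → suc (s + pred q * m)) y≡ αuv≡ ⟩
      suc (k % m + k / m * m)                 ≡⟨ cong suc (m≡m%n+[m/n]*n k m) ⟨
      suc k                                   ∎)
    where open ≡-Reasoning

  inner-attained : ∀ u x {k} → top u * m < k → k ≤ r + top u * m → Attained (u , x) k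
  inner-attained u x {k} top<k k≤ =
    let j , j<r , j≡ = window-offset top<k k≤
        y , xy , y≡ = IntervalColouring.residue-surjective γ-interval (H-regular x) j j<r in
    (u , y) , lexEdge⁻¹ G H (inner xy) ,
      trans colour-inner (trans (cong (λ s → suc (s + top u * m)) y≡) j≡)

  colour-symm : ∀ {p q} → LexEdge G H p q → colour p q ≡ colour q p
  colour-symm {u , x} {v , y} (outer uv) = begin
    colour (u , x) (v , y)                 ≡⟨ colour-outer uv ⟩
    outerColour (α u v) x y
      ≡⟨ cong₂ (λ a s → suc (s + pred a * m)) (α.symm u v uv) (sumMod-comm x y) ⟩
    outerColour (α v u) y x                ≡⟨ colour-outer (trans (adj-sym G v u) uv) ⟨
    colour (v , y) (u , x)                 ∎
    where open ≡-Reasoning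
  colour-symm {u , x} {u , y} (inner xy) = begin
    colour (u , x) (u , y)                 ≡⟨ colour-inner ⟩
    innerColour u x y                      ≡⟨ cong (λ c → suc (c % r + top u * m)) (γ.symm x y xy) ⟩
    innerColour u y x                      ≡⟨ colour-inner ⟨
    colour (u , y) (u , x)                 ∎
    where open ≡-Reasoning

  colour-range : ∀ {p q} → LexEdge G H p q → 1 ≤ colour p q × colour p q ≤ t * m + r
  colour-range {u , x} {v , y} (outer uv) rewrite colour-outer {x = x} {y} uv =
    s≤s z≤n , ≤-trans (outerColour≤top x y uv) (≤-trans (*-monoˡ-≤ m (top≤colours u)) (m≤m+n _ r))
  colour-range {u , x} {u , y} (inner _) rewrite colour-inner {u} {x} {y} =
    s≤s z≤n , ≤-trans (innerColour≤ u x y)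
                (≤-trans (+-monoʳ-≤ r (*-monoˡ-≤ m (top≤colours u))) (≤-reflexive (+-comm r (t * m))))

  colour-injective : ∀ {p q q'} → LexEdge G H p q → LexEdge G H p q' → colour p q ≡ colour p q' → q ≡ q'
  colour-injective {u , x} {v , y} {v' , y'} (outer uv) (outer uv') e
    with sumMod-eq , pred-eq ← +*-injective (sumMod<m x y) (sumMod<m x y')
           (suc-injective (trans (sym (colour-outer uv)) (trans e (colour-outer uv'))))
    with refl ← IntervalColouring.colour-injective α-interval uv uv'
                  (pred-injective {{>-nonZero (proj₁ (α.range u v uv))}}
                                  {{>-nonZero (proj₁ (α.range u v' uv'))}} pred-eq)
    = cong (v ,_) (sumMod-injectiveʳ x sumMod-eq)
  colour-injective {u , x} {v , y} {u , y'} (outer uv) (inner _) e =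
    contradiction (trans (sym (colour-outer uv)) (trans e colour-inner))
      (<⇒≢ (≤-<-trans (outerColour≤top x y uv) (top<innerColour u x y')))
  colour-injective {u , x} {u , y} {v' , y'} (inner _) (outer uv') e =
    contradiction (trans (sym (colour-outer uv')) (trans (sym e) colour-inner))
      (<⇒≢ (≤-<-trans (outerColour≤top x y' uv') (top<innerColour u x y)))
  colour-injective {u , x} {u , y} {u , y'} (inner xy) (inner xy') e =
    cong (u ,_) (IntervalColouring.residue-injective γ-interval (H-regular x) xy xy'
      (+-cancelʳ-≡ (top u * m) _ _ (suc-injective (trans (sym colour-inner) (trans e colour-inner)))))

  outerColour≤⇒≤1+quotient : ∀ {a} x y k → 1 ≤ a → outerColour a x y ≤ suc k → a ≤ suc (k / m)
  outerColour≤⇒≤1+quotient {suc a} x y k _ le = s≤s (begin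
    a          ≡⟨ m*n/n≡m a m ⟨
    a * m / m  ≤⟨ /-monoˡ-≤ m (≤-trans (m≤n+m (a * m) (sumMod x y)) (s≤s⁻¹ le)) ⟩
    k / m      ∎)
    where open ≤-Reasoning

  outer-attained-below-top : ∀ {u v} x k → adj G u v ≡ true →
                             α u v ≤ suc (k / m) → suc k ≤ top u * m → Attained (u , x) (suc k)
  outer-attained-below-top {u} {v} x k uv α≤ k<top =
    let w , uw , αuw≡top = top-attained u (≤-trans (proj₁ (α.range u v uv)) (≤top uv))
        z , uz , αuz≡ = α.interval u v w (suc (k / m)) uv uw α≤
                          (subst (suc (k / m) ≤_) (sym αuw≡top) (m<n*o⇒m/o<n k<top))
    in outer-attained x k uz αuz≡

  colour-interval : ∀ {p q q' k} → LexEdge G H p q → LexEdge G H p q' →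
                    colour p q ≤ k → k ≤ colour p q' → Attained p k
  colour-interval {u , x} {k = k} _ _ le le' with k ≤? top u * m
  colour-interval {u , x} {v , y} {k = zero} (outer uv) _ le le' | yes _ =
    contradiction (subst (_≤ 0) (colour-outer uv) le) λ ()
  colour-interval {u , x} {v , y} {k = suc k} (outer uv) _ le le' | yes k≤top =
    outer-attained-below-top x k uv
      (outerColour≤⇒≤1+quotient x y k (proj₁ (α.range u v uv)) (subst (_≤ suc k) (colour-outer uv) le)) k≤top
  colour-interval {u , x} {u , y} (inner _) _ le le' | yes k≤top =
    contradiction (<-≤-trans (top<innerColour u x y) (subst (_≤ _) colour-inner le)) (≤⇒≯ k≤top)
  colour-interval {u , x} {q' = v , y} _ (outer uv) le le' | no k≰top =
    contradiction (≤-trans le' (subst (_≤ top u * m) (sym (colour-outer uv)) (outerColour≤top x y uv)))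
      k≰top
  colour-interval {u , x} {q' = u , y} _ (inner _) le le' | no k≰top =
    inner-attained u x (≰⇒> k≰top) (≤-trans le' (subst (_≤ _) (sym colour-inner) (innerColour≤ u x y)))

  colour-used : ∀ k → 1 ≤ k → k ≤ t * m + r → ∃ λ u → Attained (u , x₀) k
  colour-used (suc k) _ k≤T with suc k ≤? t * m
  ... | yes k<tm =
    let u , v , uv , αuv≡ = α.used (suc (k / m)) (s≤s z≤n) (m<n*o⇒m/o<n k<tm)
    in u , outer-attained x₀ k uv αuv≡
  ... | no k≰tm =
    let u , v , uv , αuv≡t = α.used t 1≤t ≤-refl
        top≡t = ≤-antisym (top≤colours u) (subst (_≤ top u) αuv≡t (≤top uv))
    in u , inner-attained u x₀ (subst (λ s → s * m < suc k) (sym top≡t) (≰⇒> k≰tm))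
             (subst (λ s → suc k ≤ r + s * m) (sym top≡t) (≤-trans k≤T (≤-reflexive (+-comm (t * m) r))))

  lexColouring : EdgeColouring (G [ H ])
  lexColouring a b = colour (remQuot m a) (remQuot m b)

  isIntervalColouring : IsIntervalColouring (G [ H ]) (t * n H + r) lexColouring
  isIntervalColouring = record
    { symm     = λ a b ab → colour-symm (edge ab)
    ; range    = λ a b ab → colour-range (edge ab)
    ; used     = λ k 1≤k k≤T →
                   let u , attained = colour-used k 1≤k k≤T
                   in combine u x₀ , lift (subst (λ p → Attained p k) (sym (Fin.remQuot-combine u x₀)) attained)
    ; proper   = λ a b b' ab ab' b≢b' e →
                   b≢b' (remQuot-injective (colour-injective (edge ab) (edge ab') e))
    ; interval = λ a b b' k ab ab' l l' → lift (colour-interval (edge ab) (edge ab') l l')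
    }
    where
    edge : ∀ {a b} → adj (G [ H ]) a b ≡ true → LexEdge G H (remQuot m a) (remQuot m b)
    edge ab = lexEdge G H _ _ ab
    remQuot-injective : ∀ {a b} → remQuot {n G} m a ≡ remQuot m b → a ≡ b
    remQuot-injective {a} {b} e = trans (sym (Fin.combine-remQuot {n G} m a))
      (trans (cong (λ (u , x) → combine u x) e) (Fin.combine-remQuot {n G} m b))
    lift : ∀ {a k} → Attained (remQuot m a) k → ∃ λ b → adj (G [ H ]) a b ≡ true × lexColouring a b ≡ k
    lift {a} {k} ((v , y) , ab , e) = combine v y ,
      subst (λ q → lexAdj' G H (remQuot m a) q ≡ true × colour (remQuot m a) q ≡ k)
            (sym (Fin.remQuot-combine v y)) (ab , e)

theorem17 : (G H : Graph) (r : ℕ) →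
            IntervalColourable G → IntervalColourable H → Regular H r →
            IntervalColourable (G [ H ])
            × (∀ t → IsLeastColours G t →
                 Σ ℕ λ t' → IsLeastColours (G [ H ]) t' × t' ≤ t * n H + r)
            × (∀ T → IsGreatestColours G T →
                 Σ ℕ λ T' → IsGreatestColours (G [ H ]) T' × T * n H + r ≤ T')
theorem17 G H r G-colourable@(tG , _ , G-colouring) H-colourable@(_ , _ , _ , γ-interval) H-regular =
  (tG * n H + r , ≤-trans 1≤r (m≤n+m r _) , product-colouring G-colouring) ,
  (λ t (t-colouring , _) →
     let t' , least-t' = least P? (product-colouring t-colouring)
     in t' , least-t' , proj₂ least-t' _ (product-colouring t-colouring)) ,
  (λ T (T-colouring , _) →
     let T' , greatest-T' = greatest P? (λ _ → colours≤n² (G [ H ])) (product-colouring T-colouring)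
     in T' , greatest-T' , proj₂ greatest-T' _ (product-colouring T-colouring))
  where
  P? : Decidable (HasIntervalColouring (G [ H ]))
  P? = hasIntervalColouring? (G [ H ])
  1≤r : 1 ≤ r
  1≤r = let x₀ , _ , x₀y₀ = colourable⇒edge H-colourable in
        subst (1 ≤_) (H-regular x₀) (edge⇒1≤deg H x₀y₀)
  product-colouring : ∀ {t} → HasIntervalColouring G t → HasIntervalColouring (G [ H ]) (t * n H + r)
  product-colouring (α , α-interval) =
    let _ , _ , u₀v₀ = colourable⇒edge G-colourable
        _ , _ , x₀y₀ = colourable⇒edge H-colourable
    in _ , LexProductColouring.isIntervalColouring H-regular α-interval
             (IntervalColouring.edge⇒1≤colours α-interval u₀v₀) γ-interval x₀y₀
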